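{- Let $\mathbb{F}_q$ be a finite field with $q\ge 3$, let $C\subseteq\mathbb{F}_q^n$ be a linear code of dimension $k$, and let $x\in\mathbb{F}_q^n\setminus C$ be such that $|\mathrm{w}(C-x)|<q^k$. Then there exist a linear code $C'$ of dimension $k$ over $\mathbb{F}_q$ (of some length $n'$) and a vector $x'\in\mathbb{F}_q^{n'}\setminus C'$ such that $|\mathrm{w}(C'-x')|>|\mathrm{w}(C-x)|$.
   Context: For a set $S$ of vectors, $\mathrm{w}(S)$ denotes the set of distinct Hamming weights of the vectors in $S$. For a code $C$ and a vector $x$ of the same length, $C-x=\{c-x: c\in C\}$. In the paper, $C_k$ and $C_k'$ denote codes of dimension $k$. -}

module Defs where


open import Data.Nat using (ℕ; zero; suc)
open import Data.Fin using (Fin)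
open import Data.Vec using (Vec; []; _∷_; zipWith; replicate)
import Data.Vec
import Data.Nat
open import Data.List using (List; []; _∷_; map; concatMap; length; deduplicate; allFin)
open import Data.Product using (∃)
open import Function.Bundles using (_↔_; Inverse)
open import Relation.Nullary using (¬_; yes; no)
open import Relation.Binary.PropositionalEquality using (_≡_)
open import Relation.Binary.Definitions using (DecidableEquality)
open import Algebra.Structures using (IsCommutativeRing)

record FiniteField : Set₁ where
  infixl 6 _+_
  infixl 7 _*_
  field
    Carrier : Set
    _+_ _*_ : Carrier → Carrier → Carrier
    -_ : Carrier → Carrier
    0# 1# : Carrier
    isCommutativeRing : IsCommutativeRing _≡_ _+_ _*_ -_ 0# 1#
    0≢1 : ¬ (0# ≡ 1#)
    inverse : ∀ x → ¬ (x ≡ 0#) → ∃ λ y → x * y ≡ 1#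
    _≟_ : DecidableEquality Carrier
    q : ℕ
    enumeration : Fin q ↔ Carrier

module _ (F : FiniteField) where
  open FiniteField F

  elements : List Carrier
  elements = map (Inverse.to enumeration) (allFin q)

  allVecs : (k : ℕ) → List (Vec Carrier k)
  allVecs zero = [] ∷ []
  allVecs (suc k) = concatMap (λ a → map (a ∷_) (allVecs k)) elements

  weight : ∀ {n} → Vec Carrier n → ℕ
  weight [] = 0
  weight (a ∷ v) with a ≟ 0#
  ... | yes _ = weight v
  ... | no _  = suc (weight v)

  _-ᵥ_ : ∀ {n} → Vec Carrier n → Vec Carrier n → Vec Carrier n
  u -ᵥ v = zipWith (λ a b → a + (- b)) u v

  GenMatrix : ℕ → ℕ → Set
  GenMatrix k n = Vec (Vec Carrier n) k

  encode : ∀ {k n} → GenMatrix k n → Vec Carrier k → Vec Carrier n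
  encode [] [] = replicate _ 0#
  encode (g ∷ G) (a ∷ m) = zipWith _+_ (Data.Vec.map (a *_) g) (encode G m)

  -- The code generated by G has dimension k (G has full row rank)
  HasDimension : ∀ {k n} → GenMatrix k n → Set
  HasDimension G = ∀ m m' → encode G m ≡ encode G m' → m ≡ m'

  InCode : ∀ {k n} → GenMatrix k n → Vec Carrier n → Set
  InCode {k} G x = ∃ λ (m : Vec Carrier k) → encode G m ≡ x

  numWeights : ∀ {k n} → GenMatrix k n → Vec Carrier n → ℕ
  numWeights {k} G x =
    length (deduplicate Data.Nat._≟_ (map (λ m → weight (encode G m -ᵥ x)) (allVecs k)))

-- Over every finite field there is a k-dimensional code C and a vector x with q^k distinct
-- weights in C - x, the most possible; any pair with fewer weights is beaten by it.
-- Identify F_q with {0, …, q-1}. Take C_0 = {()}, x_0 = (1), and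
--   C_{k+1} = rows [1…1 0…0] and [0…0 | C_k],   x_{k+1} = (b_k | x_k),
-- where the block b_k is constant t on a segment of length 1 + q^k t, for each t ∈ F_q.
-- For a message with first coordinate a the block contributes |b_k| - 1 - q^k a to the
-- weight, so the weight of c - x is a constant minus the base-q value of the message.

module Submission where

open import Defs
open import Data.Nat using (ℕ; _≤_; _<_; _^_)
open import Data.Vec using (Vec)
open import Data.Product using (Σ; _×_)
open import Relation.Nullary using (¬_)

open import Algebra.Bundles using (CommutativeRing)
import Algebra.Properties.Ring as RingProperties
open import Algebra.Structures using (IsCommutativeRing)
open import Data.Empty using (⊥-elim)
open import Data.Fin using (Fin; toℕ; combine; remQuot) renaming (zero to fzero; suc to fsuc)
open import Data.Fin.Properties using (toℕ-combine; combine-remQuot; remQuot-combine; toℕ-injective; injective⇒≤; 0≢1+n; suc-injective)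
open import Data.List using (List; length; lookup; deduplicate)
open import Data.List.Membership.Propositional using (_∈_)
open import Data.List.Membership.Propositional.Properties using (∈-map⁺; ∈-concat⁺′; ∈-allFin; ∈-deduplicate⁺)
open import Data.List.Relation.Unary.Any using (here; index)
open import Data.List.Relation.Unary.Any.Properties using (lookup-index)
open import Data.Nat using (zero; suc; _+_; _*_) renaming (_≟_ to _≟ℕ_)
open import Data.Nat.Properties using (≤-trans; ≤-reflexive; <-irrefl; m≤n+m; +-comm; +-assoc; +-cancelˡ-≡; +-cancelʳ-≡)
open import Data.Nat.Tactic.RingSolver using (solve-∀)
open import Data.Product using (_,_; proj₁; proj₂)
open import Data.Vec using ([]; _∷_; _++_; replicate; zipWith)
import Data.Vec as Vec
open import Data.Vec.Properties using (map-++; zipWith-++; map-replicate; zipWith-identityˡ; zipWith-identityʳ)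
open import Function using (_∘_)
open import Function.Bundles using (Inverse; Injection)
open import Function.Definitions using (Injective)
open import Function.Properties.Inverse using (↔⇒↣)
open import Relation.Binary.PropositionalEquality using (_≡_; _≢_; refl; sym; trans; cong; cong₂; subst; module ≡-Reasoning)
open import Relation.Nullary using (yes; no)

open ≡-Reasoning

length-≥-of-injection : ∀ {a} {A : Set a} {m} {xs : List A} (f : Fin m → A) →
  Injective _≡_ _≡_ f → (∀ i → f i ∈ xs) → m ≤ length xs
length-≥-of-injection {xs = xs} f f-injective f∈xs = injective⇒≤ position-injective
  where
  position-injective : Injective _≡_ _≡_ (λ i → index (f∈xs i))
  position-injective {i} {j} eq = f-injective (begin
    f i                        ≡⟨ lookup-index (f∈xs i) ⟩
    lookup xs (index (f∈xs i)) ≡⟨ cong (lookup xs) eq ⟩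
    lookup xs (index (f∈xs j)) ≡⟨ lookup-index (f∈xs j) ⟨
    f j                        ∎)

replicate-+ : ∀ {a} {A : Set a} m n (x : A) → replicate (m + n) x ≡ replicate m x ++ replicate n x
replicate-+ zero    n x = refl
replicate-+ (suc m) n x = cong (x ∷_) (replicate-+ m n x)

∑ : ∀ {n} → (Fin n → ℕ) → ℕ
∑ {zero}  c = 0
∑ {suc n} c = c fzero + ∑ (c ∘ fsuc)

module ManyWeights (F : FiniteField) where

  open FiniteField F renaming (_+_ to _+ᶠ_; _*_ to _*ᶠ_; _≟_ to _≟ᶠ_)
  open IsCommutativeRing isCommutativeRing using (zeroʳ; +-identityˡ; +-identityʳ; *-identityʳ; -‿inverseʳ)

  commutativeRing : CommutativeRing _ _
  commutativeRing = record { isCommutativeRing = isCommutativeRing }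

  open RingProperties (CommutativeRing.ring commutativeRing) using (x∙y⁻¹≈ε⇒x≈y)

  toFin : Carrier → Fin q
  toFin = Inverse.from enumeration

  fromFin : Fin q → Carrier
  fromFin = Inverse.to enumeration

  fromFin-toFin : ∀ a → fromFin (toFin a) ≡ a
  fromFin-toFin = Inverse.strictlyInverseˡ enumeration

  toFin-fromFin : ∀ t → toFin (fromFin t) ≡ t
  toFin-fromFin = Inverse.strictlyInverseʳ enumeration

  fromFin-injective : Injective _≡_ _≡_ fromFin
  fromFin-injective = Injection.injective (↔⇒↣ enumeration)

  elements-complete : ∀ a → a ∈ elements F
  elements-complete a = subst (_∈ elements F) (fromFin-toFin a) (∈-map⁺ fromFin (∈-allFin (toFin a)))

  allVecs-complete : ∀ {k} (m : Vec Carrier k) → m ∈ allVecs F k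
  allVecs-complete []      = here refl
  allVecs-complete (a ∷ m) =
    ∈-concat⁺′ (∈-map⁺ (a ∷_) (allVecs-complete m)) (∈-map⁺ _ (elements-complete a))

  messageIndex : ∀ {k} → Vec Carrier k → Fin (q ^ k)
  messageIndex []      = fzero
  messageIndex (a ∷ m) = combine (toFin a) (messageIndex m)

  messageAt : ∀ k → Fin (q ^ k) → Vec Carrier k
  messageAt zero    _ = []
  messageAt (suc k) t = let (i , j) = remQuot {q} (q ^ k) t in fromFin i ∷ messageAt k j

  messageIndex-messageAt : ∀ k t → messageIndex (messageAt k t) ≡ t
  messageIndex-messageAt zero    fzero = refl
  messageIndex-messageAt (suc k) t     = begin
    combine (toFin (fromFin i)) (messageIndex (messageAt k j))
      ≡⟨ cong₂ combine (toFin-fromFin i) (messageIndex-messageAt k j) ⟩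
    combine i j
      ≡⟨ combine-remQuot {q} (q ^ k) t ⟩
    t ∎
    where
    i = proj₁ (remQuot {q} (q ^ k) t)
    j = proj₂ (remQuot {q} (q ^ k) t)

  messageAt-messageIndex : ∀ {k} (m : Vec Carrier k) → messageAt k (messageIndex m) ≡ m
  messageAt-messageIndex []      = refl
  messageAt-messageIndex {suc k} (a ∷ m) = begin
    messageAt (suc k) (combine (toFin a) (messageIndex m))
      ≡⟨ cong (λ (i , j) → fromFin i ∷ messageAt k j) (remQuot-combine {k = q ^ k} (toFin a) (messageIndex m)) ⟩
    fromFin (toFin a) ∷ messageAt k (messageIndex m)
      ≡⟨ cong₂ _∷_ (fromFin-toFin a) (messageAt-messageIndex m) ⟩
    a ∷ m ∎

  messageAt-injective : ∀ k → Injective _≡_ _≡_ (messageAt k)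
  messageAt-injective k {t} {u} eq = begin
    t                            ≡⟨ messageIndex-messageAt k t ⟨
    messageIndex (messageAt k t) ≡⟨ cong messageIndex eq ⟩
    messageIndex (messageAt k u) ≡⟨ messageIndex-messageAt k u ⟩
    u                            ∎

  messageIndex-injective : ∀ {k} → Injective _≡_ _≡_ (messageIndex {k})
  messageIndex-injective {k} {m} {m′} eq = begin
    m                            ≡⟨ messageAt-messageIndex m ⟨
    messageAt k (messageIndex m)  ≡⟨ cong (messageAt k) eq ⟩
    messageAt k (messageIndex m′) ≡⟨ messageAt-messageIndex m′ ⟩
    m′                           ∎

  wt : ∀ {n} → Vec Carrier n → ℕ
  wt = weight F

  infixl 6 _⊖_
  _⊖_ : ∀ {n} → Vec Carrier n → Vec Carrier n → Vec Carrier n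
  _⊖_ = _-ᵥ_ F

  wt-++ : ∀ {m n} (u : Vec Carrier m) (v : Vec Carrier n) → wt (u ++ v) ≡ wt u + wt v
  wt-++ []      v = refl
  wt-++ (a ∷ u) v with a ≟ᶠ 0#
  ... | yes _ = wt-++ u v
  ... | no  _ = cong suc (wt-++ u v)

  wt-⊖-++ : ∀ {m n} (u v : Vec Carrier m) (u′ v′ : Vec Carrier n) →
    wt ((u ++ u′) ⊖ (v ++ v′)) ≡ wt (u ⊖ v) + wt (u′ ⊖ v′)
  wt-⊖-++ u v u′ v′ = trans (cong wt (zipWith-++ _ u u′ v v′)) (wt-++ (u ⊖ v) (u′ ⊖ v′))

  wt-⊖-self : ∀ {n} (v : Vec Carrier n) → wt (v ⊖ v) ≡ 0
  wt-⊖-self []      = refl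
  wt-⊖-self (a ∷ v) with (a +ᶠ - a) ≟ᶠ 0#
  ... | yes _  = wt-⊖-self v
  ... | no  ≢0 = ⊥-elim (≢0 (-‿inverseʳ a))

  wt-replicate-⊖-replicate : ∀ n {a b} → a ≢ b → wt (replicate n a ⊖ replicate n b) ≡ n
  wt-replicate-⊖-replicate zero    a≢b = refl
  wt-replicate-⊖-replicate (suc n) {a} {b} a≢b with (a +ᶠ - b) ≟ᶠ 0#
  ... | yes ≡0 = ⊥-elim (a≢b (x∙y⁻¹≈ε⇒x≈y a b ≡0))
  ... | no  _  = cong suc (wt-replicate-⊖-replicate n a≢b)

  blocks : ∀ {n} → (Fin n → Carrier) → (c : Fin n → ℕ) → Vec Carrier (∑ c)
  blocks {zero}  f c = []
  blocks {suc n} f c = replicate (c fzero) (f fzero) ++ blocks (f ∘ fsuc) (c ∘ fsuc)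

  wt-replicate-⊖-blocks-split : ∀ {n} (f : Fin (suc n) → Carrier) c a →
    wt (replicate (∑ c) a ⊖ blocks f c)
      ≡ wt (replicate (c fzero) a ⊖ replicate (c fzero) (f fzero))
        + wt (replicate (∑ (c ∘ fsuc)) a ⊖ blocks (f ∘ fsuc) (c ∘ fsuc))
  wt-replicate-⊖-blocks-split f c a =
    trans (cong (λ v → wt (v ⊖ blocks f c)) (replicate-+ (c fzero) (∑ (c ∘ fsuc)) a))
          (wt-⊖-++ (replicate (c fzero) a) _ (replicate (∑ (c ∘ fsuc)) a) _)

  wt-replicate-⊖-blocks-∉ : ∀ {n} (f : Fin n → Carrier) (c : Fin n → ℕ) {a} → (∀ j → f j ≢ a) →
    wt (replicate (∑ c) a ⊖ blocks f c) ≡ ∑ c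
  wt-replicate-⊖-blocks-∉ {zero}  f c a∉f = refl
  wt-replicate-⊖-blocks-∉ {suc n} f c {a} a∉f = trans (wt-replicate-⊖-blocks-split f c a)
    (cong₂ _+_ (wt-replicate-⊖-replicate (c fzero) (a∉f fzero ∘ sym))
               (wt-replicate-⊖-blocks-∉ (f ∘ fsuc) (c ∘ fsuc) (a∉f ∘ fsuc)))

  wt-replicate-⊖-blocks : ∀ {n} {f : Fin n → Carrier} (c : Fin n → ℕ) → Injective _≡_ _≡_ f → ∀ i →
    wt (replicate (∑ c) (f i) ⊖ blocks f c) + c i ≡ ∑ c
  wt-replicate-⊖-blocks {suc n} {f} c f-injective i =
    trans (cong (_+ c i) (wt-replicate-⊖-blocks-split f c (f i))) (by-position i)
    where
    tail-wt : Carrier → ℕ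
    tail-wt a = wt (replicate (∑ (c ∘ fsuc)) a ⊖ blocks (f ∘ fsuc) (c ∘ fsuc))

    by-position : ∀ i → wt (replicate (c fzero) (f i) ⊖ replicate (c fzero) (f fzero)) + tail-wt (f i) + c i ≡ ∑ c
    by-position fzero = begin
      wt (replicate (c fzero) (f fzero) ⊖ replicate (c fzero) (f fzero)) + tail-wt (f fzero) + c fzero
        ≡⟨ cong₂ (λ h t → h + t + c fzero) (wt-⊖-self (replicate (c fzero) (f fzero)))
                 (wt-replicate-⊖-blocks-∉ (f ∘ fsuc) (c ∘ fsuc) (λ j → 0≢1+n ∘ sym ∘ f-injective)) ⟩
      ∑ (c ∘ fsuc) + c fzero
        ≡⟨ +-comm (∑ (c ∘ fsuc)) (c fzero) ⟩
      ∑ c ∎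
    by-position (fsuc i) = begin
      wt (replicate (c fzero) (f (fsuc i)) ⊖ replicate (c fzero) (f fzero)) + tail-wt (f (fsuc i)) + c (fsuc i)
        ≡⟨ cong (λ h → h + tail-wt (f (fsuc i)) + c (fsuc i))
                (wt-replicate-⊖-replicate (c fzero) (0≢1+n ∘ sym ∘ f-injective)) ⟩
      c fzero + tail-wt (f (fsuc i)) + c (fsuc i)
        ≡⟨ +-assoc (c fzero) (tail-wt (f (fsuc i))) (c (fsuc i)) ⟩
      c fzero + (tail-wt (f (fsuc i)) + c (fsuc i))
        ≡⟨ cong (c fzero +_) (wt-replicate-⊖-blocks (c ∘ fsuc) (suc-injective ∘ f-injective) i) ⟩
      ∑ c ∎

  zeros : ∀ n → Vec Carrier n
  zeros n = replicate n 0#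

  zeros-scaled-+ : ∀ {n} a (v : Vec Carrier n) → zipWith _+ᶠ_ (Vec.map (a *ᶠ_) (zeros n)) v ≡ v
  zeros-scaled-+ {n} a v = begin
    zipWith _+ᶠ_ (Vec.map (a *ᶠ_) (zeros n)) v ≡⟨ cong (λ z → zipWith _+ᶠ_ z v) (map-replicate (a *ᶠ_) 0# n) ⟩
    zipWith _+ᶠ_ (replicate n (a *ᶠ 0#)) v    ≡⟨ cong (λ z → zipWith _+ᶠ_ (replicate n z) v) (zeroʳ a) ⟩
    zipWith _+ᶠ_ (zeros n) v                  ≡⟨ zipWith-identityˡ +-identityˡ v ⟩
    v                                         ∎

  ones-scaled-+-zeros : ∀ n a → zipWith _+ᶠ_ (Vec.map (a *ᶠ_) (replicate n 1#)) (zeros n) ≡ replicate n a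
  ones-scaled-+-zeros n a = begin
    zipWith _+ᶠ_ (Vec.map (a *ᶠ_) (replicate n 1#)) (zeros n) ≡⟨ zipWith-identityʳ +-identityʳ _ ⟩
    Vec.map (a *ᶠ_) (replicate n 1#)                          ≡⟨ map-replicate (a *ᶠ_) 1# n ⟩
    replicate n (a *ᶠ 1#)                                     ≡⟨ cong (replicate n) (*-identityʳ a) ⟩
    replicate n a                                             ∎

  encode-zeros-++ : ∀ {k n} L (G : GenMatrix F k n) m →
    encode F (Vec.map (zeros L ++_) G) m ≡ zeros L ++ encode F G m
  encode-zeros-++ {n = n} L []      []      = replicate-+ L n 0#
  encode-zeros-++         L (g ∷ G) (a ∷ m) = begin
    zipWith _+ᶠ_ (Vec.map (a *ᶠ_) (zeros L ++ g)) (encode F (Vec.map (zeros L ++_) G) m)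
      ≡⟨ cong₂ (zipWith _+ᶠ_) (map-++ (a *ᶠ_) (zeros L) g) (encode-zeros-++ L G m) ⟩
    zipWith _+ᶠ_ (Vec.map (a *ᶠ_) (zeros L) ++ Vec.map (a *ᶠ_) g) (zeros L ++ encode F G m)
      ≡⟨ zipWith-++ _+ᶠ_ (Vec.map (a *ᶠ_) (zeros L)) _ (zeros L) _ ⟩
    zipWith _+ᶠ_ (Vec.map (a *ᶠ_) (zeros L)) (zeros L) ++ encode F (g ∷ G) (a ∷ m)
      ≡⟨ cong (_++ encode F (g ∷ G) (a ∷ m)) (zeros-scaled-+ a (zeros L)) ⟩
    zeros L ++ encode F (g ∷ G) (a ∷ m) ∎

  encode-stacked : ∀ {k n} L (G : GenMatrix F k n) a m →
    encode F ((replicate L 1# ++ zeros n) ∷ Vec.map (zeros L ++_) G) (a ∷ m) ≡ replicate L a ++ encode F G m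
  encode-stacked {n = n} L G a m = begin
    zipWith _+ᶠ_ (Vec.map (a *ᶠ_) (replicate L 1# ++ zeros n)) (encode F (Vec.map (zeros L ++_) G) m)
      ≡⟨ cong₂ (zipWith _+ᶠ_) (map-++ (a *ᶠ_) (replicate L 1#) (zeros n)) (encode-zeros-++ L G m) ⟩
    zipWith _+ᶠ_ (Vec.map (a *ᶠ_) (replicate L 1#) ++ Vec.map (a *ᶠ_) (zeros n)) (zeros L ++ encode F G m)
      ≡⟨ zipWith-++ _+ᶠ_ (Vec.map (a *ᶠ_) (replicate L 1#)) _ (zeros L) _ ⟩
    zipWith _+ᶠ_ (Vec.map (a *ᶠ_) (replicate L 1#)) (zeros L) ++ zipWith _+ᶠ_ (Vec.map (a *ᶠ_) (zeros n)) (encode F G m)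
      ≡⟨ cong₂ _++_ (ones-scaled-+-zeros L a) (zeros-scaled-+ a (encode F G m)) ⟩
    replicate L a ++ encode F G m ∎

  q^k≤numWeights : ∀ {k n} (G : GenMatrix F k n) x →
    Injective _≡_ _≡_ (λ m → wt (encode F G m ⊖ x)) → q ^ k ≤ numWeights F G x
  q^k≤numWeights {k} G x weight-injective =
    length-≥-of-injection (distanceAt ∘ messageAt k) (messageAt-injective k ∘ weight-injective)
      (λ t → ∈-deduplicate⁺ _≟ℕ_ (∈-map⁺ distanceAt (allVecs-complete (messageAt k t))))
    where
    distanceAt : Vec Carrier k → ℕ
    distanceAt m = wt (encode F G m ⊖ x)

  segmentLength : ℕ → Fin q → ℕ
  segmentLength D t = suc (D * toℕ t)

  blockLength : ℕ → ℕ
  blockLength k = ∑ (segmentLength (q ^ k))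

  block : ∀ k → Vec Carrier (blockLength k)
  block k = blocks fromFin (segmentLength (q ^ k))

  codeLength : ℕ → ℕ
  codeLength zero    = 1
  codeLength (suc k) = blockLength k + codeLength k

  generator : ∀ k → GenMatrix F k (codeLength k)
  generator zero    = []
  generator (suc k) =
    (replicate (blockLength k) 1# ++ zeros (codeLength k)) ∷ Vec.map (zeros (blockLength k) ++_) (generator k)

  target : ∀ k → Vec Carrier (codeLength k)
  target zero    = 1# ∷ []
  target (suc k) = block k ++ target k

  distance : ∀ k → Vec Carrier k → ℕ
  distance k m = wt (encode F (generator k) m ⊖ target k)

  distance-∷ : ∀ k a m → distance (suc k) (a ∷ m) ≡ wt (replicate (blockLength k) a ⊖ block k) + distance k m
  distance-∷ k a m = begin
    wt (encode F (generator (suc k)) (a ∷ m) ⊖ (block k ++ target k))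
      ≡⟨ cong (λ c → wt (c ⊖ (block k ++ target k))) (encode-stacked (blockLength k) (generator k) a m) ⟩
    wt ((replicate (blockLength k) a ++ encode F (generator k) m) ⊖ (block k ++ target k))
      ≡⟨ wt-⊖-++ (replicate (blockLength k) a) (block k) (encode F (generator k) m) (target k) ⟩
    wt (replicate (blockLength k) a ⊖ block k) + distance k m ∎

  wt-replicate-⊖-block : ∀ k a → wt (replicate (blockLength k) a ⊖ block k) + suc (q ^ k * toℕ (toFin a)) ≡ blockLength k
  wt-replicate-⊖-block k a =
    subst (λ b → wt (replicate (blockLength k) b ⊖ block k) + segmentLength (q ^ k) (toFin a) ≡ blockLength k)
      (fromFin-toFin a) (wt-replicate-⊖-blocks (segmentLength (q ^ k)) fromFin-injective (toFin a))

  distance-+-messageIndex : ∀ k m → distance k m + toℕ (messageIndex m) + k ≡ codeLength k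
  distance-+-messageIndex zero    []      = cong (λ d → d + 0 + 0) (wt-replicate-⊖-replicate 1 0≢1)
  distance-+-messageIndex (suc k) (a ∷ m) = begin
    distance (suc k) (a ∷ m) + toℕ (combine (toFin a) (messageIndex m)) + suc k
      ≡⟨ cong₂ (λ d i → d + i + suc k) (distance-∷ k a m) (toℕ-combine (toFin a) (messageIndex m)) ⟩
    (blockWt + distance k m) + (offset + toℕ (messageIndex m)) + suc k
      ≡⟨ regroup blockWt (distance k m) offset (toℕ (messageIndex m)) k ⟩
    (blockWt + suc offset) + (distance k m + toℕ (messageIndex m) + k)
      ≡⟨ cong₂ _+_ (wt-replicate-⊖-block k a) (distance-+-messageIndex k m) ⟩
    codeLength (suc k) ∎
    where
    blockWt = wt (replicate (blockLength k) a ⊖ block k)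
    offset  = q ^ k * toℕ (toFin a)
    regroup : ∀ b d s i k → (b + d) + (s + i) + suc k ≡ (b + suc s) + (d + i + k)
    regroup = solve-∀

  distance-injective : ∀ k → Injective _≡_ _≡_ (distance k)
  distance-injective k {m} {m′} eq = messageIndex-injective (toℕ-injective
    (+-cancelˡ-≡ (distance k m) _ _ (+-cancelʳ-≡ k _ _ (begin
      distance k m + toℕ (messageIndex m) + k   ≡⟨ distance-+-messageIndex k m ⟩
      codeLength k                              ≡⟨ distance-+-messageIndex k m′ ⟨
      distance k m′ + toℕ (messageIndex m′) + k ≡⟨ cong (λ d → d + toℕ (messageIndex m′) + k) eq ⟨
      distance k m + toℕ (messageIndex m′) + k  ∎))))

  generator-hasDimension : ∀ k → HasDimension F (generator k)
  generator-hasDimension k m m′ eq = distance-injective k (cong (λ c → wt (c ⊖ target k)) eq)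

  distance-positive : ∀ k m → 1 ≤ distance k m
  distance-positive zero    []      = ≤-reflexive (sym (wt-replicate-⊖-replicate 1 0≢1))
  distance-positive (suc k) (a ∷ m) rewrite distance-∷ k a m = ≤-trans (distance-positive k m) (m≤n+m _ _)

  target-∉-code : ∀ k → ¬ InCode F (generator k) (target k)
  target-∉-code k (m , encode≡target) = <-irrefl refl (subst (1 ≤_) distance≡0 (distance-positive k m))
    where
    distance≡0 : distance k m ≡ 0
    distance≡0 = trans (cong (λ c → wt (c ⊖ target k)) encode≡target) (wt-⊖-self (target k))

-- The construction works over every finite field.
lemma2 : (F : FiniteField) → 3 ≤ FiniteField.q F →
    (n k : ℕ) (G : GenMatrix F k n) → HasDimension F G →
    (x : Vec (FiniteField.Carrier F) n) → ¬ InCode F G x →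
    numWeights F G x < FiniteField.q F ^ k →
    Σ ℕ λ n′ → Σ (GenMatrix F k n′) λ G′ → HasDimension F G′ ×
      Σ (Vec (FiniteField.Carrier F) n′) λ x′ → ¬ InCode F G′ x′ ×
        numWeights F G x < numWeights F G′ x′
lemma2 F _ n k G _ x _ numWeights<q^k =
  codeLength k , generator k , generator-hasDimension k , target k , target-∉-code k ,
  ≤-trans numWeights<q^k (q^k≤numWeights (generator k) (target k) (distance-injective k))
  where open ManyWeights F
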